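{- Let $(G_1,u_1)$, $(G_2,u_2)$ and $(G_2',u_2')$ be rooted skeletal triangulations such that $(G_2,u_2)$ and $(G_2',u_2')$ act as the same type (AB, LR or Nope). Let $H$ be obtained by fusing $(G_2,u_2)$ to $(G_1,u_1)$ and $H'$ by fusing $(G_2',u_2')$ to $(G_1,u_1)$. Then $\gamma(H) - \gamma(G_2,u_2) = \gamma(H') - \gamma(G_2',u_2')$; that is, $\gamma(H)-\gamma(G_2,u_2)$ depends only on $(G_1,u_1)$ and the act-as type of $(G_2,u_2)$.
   Context: A rooted skeletal triangulation $(G,u)$ is a connected plane graph in which every bounded face is a triangle and every vertex except possibly the root $u$ has degree at least $2$. A rooted dominating set of $(G,u)$ is a vertex set $S$ such that every vertex other than $u$ is in $S$ or adjacent to $S$; $\gamma(G,u)$ is the minimum size of one. $(G,u)$ acts as AB if some rooted dominating set of size $\gamma(G,u)$ contains $u$; otherwise as LR if some rooted dominating set of size $\gamma(G,u)$ contains a neighbor of $u$; otherwise as Nope. Fusing $(G_2,u_2)$ to $(G_1,u_1)$ means taking the disjoint union $G_1\sqcup G_2$ and identifying $u_1$ with $u_2$. $\gamma(H)$ is the minimum size of a dominating set of $H$. -}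

module Defs where

open import Data.Bool using (Bool; true; false; _∧_; if_then_else_)
open import Data.Nat using (ℕ; zero; suc; _+_; _*_; _≤_; _≤ᵇ_)
open import Data.Fin using (Fin; toℕ; splitAt; punchIn; _≟_)
open import Data.Fin.Subset using (Subset; _∈_; ∣_∣)
open import Data.List using (List; length; filterᵇ; allFin; map)
open import Data.Nat.ListAction using (sum)
open import Data.Product using (_×_; _,_; ∃; Σ; proj₁; proj₂)
open import Data.Sum using (_⊎_; inj₁; inj₂)
open import Relation.Nullary using (¬_; ⌊_⌋)
open import Relation.Binary.PropositionalEquality using (_≡_; _≢_)

Adj : ℕ → Set
Adj n = Fin n → Fin n → Bool

iter : ∀ {A : Set} → (A → A) → ℕ → A → A
iter f zero    x = x
iter f (suc k) x = f (iter f k x)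

data Reach {n : ℕ} (adj : Adj n) : Fin n → Fin n → Set where
  here : ∀ {v} → Reach adj v v
  step : ∀ {v w x} → adj v w ≡ true → Reach adj w x → Reach adj v x

Connected : ∀ {n} → Adj n → Set
Connected adj = ∀ v w → Reach adj v w

deg : ∀ {n} → Adj n → Fin n → ℕ
deg {n} adj v = length (filterᵇ (adj v) (allFin n))

-- A dart is an ordered pair (v , w) with adj v w ≡ true.
-- rot v w = neighbour of v following w in the cyclic order around v.

Dart : ℕ → Set
Dart n = Fin n × Fin n

faceStep : ∀ {n} → (Fin n → Fin n → Fin n) → Dart n → Dart n
faceStep rot (v , w) = (w , rot w v)

IsDart : ∀ {n} → Adj n → Dart n → Set
IsDart adj (v , w) = adj v w ≡ true

code : ∀ {n} → Dart n → ℕ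
code {n} (v , w) = toℕ v * n + toℕ w

allBelow : ℕ → (ℕ → Bool) → Bool
allBelow zero    p = true
allBelow (suc k) p = allBelow k p ∧ p k

-- d is the code-minimal dart of its face orbit (orbits have length ≤ n*n)
isFaceRep : ∀ {n} → (Fin n → Fin n → Fin n) → Dart n → Bool
isFaceRep {n} rot d = allBelow (n * n) (λ k → code d ≤ᵇ code (iter (faceStep rot) k d))

dartCount : ∀ {n} → Adj n → ℕ
dartCount {n} adj = sum (map (λ v → deg adj v) (allFin n))

faceCount : ∀ {n} → Adj n → (Fin n → Fin n → Fin n) → ℕ
faceCount {n} adj rot =
  sum (map (λ v → length (filterᵇ (λ w → adj v w ∧ isFaceRep rot (v , w)) (allFin n)))
           (allFin n))

record RotationSystem {n : ℕ} (adj : Adj n) (rot : Fin n → Fin n → Fin n) : Set where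
  field
    rot-adj : ∀ v w → adj v w ≡ true → adj v (rot v w) ≡ true
    rot-inj : ∀ v w w' → adj v w ≡ true → adj v w' ≡ true → rot v w ≡ rot v w' → w ≡ w'
    rot-cyc : ∀ v w w' → adj v w ≡ true → adj v w' ≡ true → ∃ λ k → iter (rot v) k w ≡ w'

-- Genus-0 embedding: Euler's formula V - E + F = 2 (E = darts/2);
-- the edgeless (one-vertex) case is planar trivially.
Spherical : ∀ {n} → Adj n → (Fin n → Fin n → Fin n) → Set
Spherical {n} adj rot =
  dartCount adj ≡ 0 ⊎ 2 * n + 2 * faceCount adj rot ≡ 4 + dartCount adj

-- all faces but (at most) one, the outer face, are triangles
BoundedFacesTriangles : ∀ {n} → Adj n → (Fin n → Fin n → Fin n) → Set
BoundedFacesTriangles adj rot =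
  ∀ d d' → IsDart adj d → IsDart adj d' →
    iter (faceStep rot) 3 d ≢ d → iter (faceStep rot) 3 d' ≢ d' →
    ∃ λ k → iter (faceStep rot) k d ≡ d'

record SkeletalTriangulation {n : ℕ} (adj : Adj n) (u : Fin n) : Set where
  field
    symmetric : ∀ v w → adj v w ≡ adj w v
    irreflexive : ∀ v → adj v v ≡ false
    connected : Connected adj
    deg≥2 : ∀ v → v ≢ u → 2 ≤ deg adj v
    rot : Fin n → Fin n → Fin n
    rotation : RotationSystem adj rot
    spherical : Spherical adj rot
    triangular : BoundedFacesTriangles adj rot

Dominated : ∀ {n} → Adj n → Subset n → Fin n → Set
Dominated adj S v = v ∈ S ⊎ ∃ λ w → w ∈ S × adj w v ≡ true

DominatingSet : ∀ {n} → Adj n → Subset n → Set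
DominatingSet adj S = ∀ v → Dominated adj S v

RootedDominatingSet : ∀ {n} → Adj n → Fin n → Subset n → Set
RootedDominatingSet adj u S = ∀ v → v ≢ u → Dominated adj S v

IsDomNum : ∀ {n} → Adj n → ℕ → Set
IsDomNum adj k =
  (∃ λ S → DominatingSet adj S × ∣ S ∣ ≡ k) × (∀ S → DominatingSet adj S → k ≤ ∣ S ∣)

IsRootedDomNum : ∀ {n} → Adj n → Fin n → ℕ → Set
IsRootedDomNum adj u k =
  (∃ λ S → RootedDominatingSet adj u S × ∣ S ∣ ≡ k) ×
  (∀ S → RootedDominatingSet adj u S → k ≤ ∣ S ∣)

MinRootedDominatingSet : ∀ {n} → Adj n → Fin n → Subset n → Set
MinRootedDominatingSet adj u S =
  RootedDominatingSet adj u S × (∀ T → RootedDominatingSet adj u T → ∣ S ∣ ≤ ∣ T ∣)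

HasMinRDSWithRoot : ∀ {n} → Adj n → Fin n → Set
HasMinRDSWithRoot adj u = ∃ λ S → MinRootedDominatingSet adj u S × u ∈ S

HasMinRDSWithNbr : ∀ {n} → Adj n → Fin n → Set
HasMinRDSWithNbr adj u =
  ∃ λ S → MinRootedDominatingSet adj u S × (∃ λ w → adj u w ≡ true × w ∈ S)

data ActType : Set where
  AB LR Nope : ActType

ActsAs : ∀ {n} → Adj n → Fin n → ActType → Set
ActsAs adj u AB   = HasMinRDSWithRoot adj u
ActsAs adj u LR   = ¬ HasMinRDSWithRoot adj u × HasMinRDSWithNbr adj u
ActsAs adj u Nope = ¬ HasMinRDSWithRoot adj u × ¬ HasMinRDSWithNbr adj u

-- Fusing (G2 , u2) to (G1 , u1).  Vertices of H: Fin (n1 + m), where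
-- inj₁ x ↦ vertex x of G1 (u1 is the fused vertex) and
-- inj₂ j ↦ vertex punchIn u2 j of G2 (all vertices of G2 other than u2).

eqᵇ : ∀ {n} → Fin n → Fin n → Bool
eqᵇ x y = ⌊ x ≟ y ⌋

fuseAdj : ∀ {n1 m} → Adj n1 → Fin n1 → Adj (suc m) → Fin (suc m) → Adj (n1 + m)
fuseAdj {n1} adj1 u1 adj2 u2 a b with splitAt n1 a | splitAt n1 b
... | inj₁ x | inj₁ y = adj1 x y
... | inj₁ x | inj₂ j = eqᵇ x u1 ∧ adj2 u2 (punchIn u2 j)
... | inj₂ i | inj₁ y = eqᵇ y u1 ∧ adj2 (punchIn u2 i) u2
... | inj₂ i | inj₂ j = adj2 (punchIn u2 i) (punchIn u2 j)

-- Split a dominating set D of H′ into its part X in G₁ and its part Y in G₂′ − u₂′.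
-- X dominates G₁ − u₁, and Y (plus u₂′ when u₁ ∈ X) is a rooted dominating set of
-- G₂′, so γ(G₂′,u₂′) ≤ |Y| + [u₁ ∈ X]. Conversely X, enlarged by u₁ where needed,
-- together with a minimum rooted dominating set S of G₂ with u₂ removed, dominates H.
-- Matching the choice of S to the common act-as type of G₂ and G₂′ (S ∋ u₂ for AB,
-- S containing a neighbour of u₂ for LR) gives γ(H) + γ(G₂′,u₂′) ≤ |D| + γ(G₂,u₂);
-- with D minimum and the roles of G₂, G₂′ exchanged this is the claimed equality.
module Submission where

open import Defs
open import Data.Bool using (Bool; true; false; _∧_)
open import Data.Nat using (ℕ; zero; suc; _+_; _≤_; _<_; _≤?_; s≤s⁻¹)
open import Data.Nat.Properties
  using (module ≤-Reasoning; ≤-trans; ≤-antisym; ≰⇒>; +-suc; +-comm; +-assoc; +-identityʳ;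
         +-mono-≤; +-monoʳ-≤; +-cancelˡ-≤)
open import Data.Nat.Tactic.RingSolver using (solve-∀)
open import Data.Fin using (Fin; zero; suc; splitAt; join; punchIn; punchOut; _≟_)
open import Data.Fin.Properties
  using (splitAt-join; join-splitAt; punchIn-punchOut; punchOut-punchIn; punchInᵢ≢i)
open import Data.Fin.Subset using (Subset; _∈_; _⊆_; ∣_∣; inside)
import Data.Vec as Vec
open import Data.Vec using ([]; _∷_; lookup; _++_; insertAt; removeAt; _[_]≔_)
open import Data.Vec.Properties
  using (lookup-splitAt; insertAt-punchIn; insertAt-lookup; insertAt-removeAt; removeAt-punchOut;
         []=⇒lookup; lookup⇒[]=; []≔-updates; []≔-minimal)
open import Data.Sum using (_⊎_; inj₁; inj₂; [_,_]′)
open import Data.Product using (_×_; _,_; ∃; proj₁; proj₂)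
open import Function using (_∘_)
open import Relation.Nullary using (¬_; yes; no; contradiction)
open import Relation.Binary.PropositionalEquality

fromBool : Bool → ℕ
fromBool true  = 1
fromBool false = 0

∣++∣ : ∀ {m n} (p : Subset m) (q : Subset n) → ∣ p ++ q ∣ ≡ ∣ p ∣ + ∣ q ∣
∣++∣ []          q = refl
∣++∣ (true  ∷ p) q = cong suc (∣++∣ p q)
∣++∣ (false ∷ p) q = ∣++∣ p q

∣insertAt∣ : ∀ {n} (p : Subset n) i b → ∣ insertAt p i b ∣ ≡ fromBool b + ∣ p ∣
∣insertAt∣ p           zero    true  = refl
∣insertAt∣ p           zero    false = refl
∣insertAt∣ (true  ∷ p) (suc i) b     = trans (cong suc (∣insertAt∣ p i b)) (sym (+-suc (fromBool b) _))
∣insertAt∣ (false ∷ p) (suc i) b     = ∣insertAt∣ p i b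

∣removeAt∣ : ∀ {n} (p : Subset (suc n)) i → ∣ p ∣ ≡ fromBool (lookup p i) + ∣ removeAt p i ∣
∣removeAt∣ p i = begin
  ∣ p ∣                                       ≡⟨ cong ∣_∣ (insertAt-removeAt p i) ⟨
  ∣ insertAt (removeAt p i) i (lookup p i) ∣  ≡⟨ ∣insertAt∣ (removeAt p i) i (lookup p i) ⟩
  fromBool (lookup p i) + ∣ removeAt p i ∣    ∎
  where open ≡-Reasoning

∣[]≔inside∣ : ∀ {n} (p : Subset n) i → ∣ p [ i ]≔ inside ∣ + fromBool (lookup p i) ≡ suc ∣ p ∣
∣[]≔inside∣ (true  ∷ p) zero    = cong suc (+-comm ∣ p ∣ 1)
∣[]≔inside∣ (false ∷ p) zero    = cong suc (+-comm ∣ p ∣ 0)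
∣[]≔inside∣ (true  ∷ p) (suc i) = cong suc (∣[]≔inside∣ p i)
∣[]≔inside∣ (false ∷ p) (suc i) = ∣[]≔inside∣ p i

⊆-[]≔inside : ∀ {n} (p : Subset n) i → p ⊆ p [ i ]≔ inside
⊆-[]≔inside p i {x} x∈p with x ≟ i
... | yes refl = []≔-updates p i
... | no x≢i   = []≔-minimal p x i x≢i x∈p

∈-insertAt-punchIn : ∀ {n} {p : Subset n} i b {j} → j ∈ p → punchIn i j ∈ insertAt p i b
∈-insertAt-punchIn {p = p} i b {j} j∈p =
  lookup⇒[]= _ _ (trans (insertAt-punchIn p i b j) ([]=⇒lookup j∈p))

∈-insertAt-lookup : ∀ {n k} (p : Subset n) i {q : Subset k} {x} → x ∈ q → i ∈ insertAt p i (lookup q x)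
∈-insertAt-lookup p i x∈q = lookup⇒[]= _ _ (trans (insertAt-lookup p i _) ([]=⇒lookup x∈q))

∈-insertAt-inside : ∀ {n} (p : Subset n) i → i ∈ insertAt p i inside
∈-insertAt-inside p i = lookup⇒[]= _ _ (insertAt-lookup p i inside)

∈-removeAt-punchIn : ∀ {n} {p : Subset (suc n)} i {j} → punchIn i j ∈ p → j ∈ removeAt p i
∈-removeAt-punchIn {p = p} i {j} j∈p =
  lookup⇒[]= _ _ (trans (cong (lookup (removeAt p i)) (sym (punchOut-punchIn i)))
                         (trans (removeAt-punchOut p (punchInᵢ≢i i j ∘ sym)) ([]=⇒lookup j∈p)))

data PunchView {n} (i : Fin (suc n)) : Fin (suc n) → Set where
  at-i    : PunchView i i
  punched : ∀ j → PunchView i (punchIn i j)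

punchView : ∀ {n} (i v : Fin (suc n)) → PunchView i v
punchView i v with i ≟ v
... | yes refl = at-i
... | no i≢v   = subst (PunchView i) (punchIn-punchOut i≢v) (punched (punchOut i≢v))

eqᵇ-∧-true : ∀ {n} (x y : Fin n) {b} → eqᵇ x y ∧ b ≡ true → x ≡ y × b ≡ true
eqᵇ-∧-true x y p with x ≟ y
... | yes x≡y = x≡y , p

eqᵇ-refl-∧ : ∀ {n} (x : Fin n) {b} → b ≡ true → eqᵇ x x ∧ b ≡ true
eqᵇ-refl-∧ x b≡true with x ≟ x
... | yes _  = b≡true
... | no x≢x = contradiction refl x≢x

combine-bounds : ∀ a c d h g g′ x y → a + h ≤ x + g → c + g′ ≤ y → x + y ≡ a + c + d →
  h + g′ ≤ d + g
combine-bounds a c d h g g′ x y h≤ g′≤ x+y≡ = +-cancelˡ-≤ (a + c) (h + g′) (d + g) (begin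
  a + c + (h + g′)    ≡⟨ interchange a c h g′ ⟩
  (a + h) + (c + g′)  ≤⟨ +-mono-≤ h≤ g′≤ ⟩
  (x + g) + y         ≡⟨ trans (swap-last x g y) (cong (_+ g) x+y≡) ⟩
  a + c + d + g       ≡⟨ +-assoc (a + c) d g ⟩
  a + c + (d + g)     ∎)
  where
  open ≤-Reasoning
  interchange : ∀ a c h g′ → a + c + (h + g′) ≡ (a + h) + (c + g′)
  interchange = solve-∀
  swap-last : ∀ x g y → (x + g) + y ≡ (x + y) + g
  swap-last = solve-∀

module _ {n} {adj : Adj n} {u : Fin n} where

  Dominated-mono : ∀ {p q v} → p ⊆ q → Dominated adj p v → Dominated adj q v
  Dominated-mono p⊆q (inj₁ v∈)           = inj₁ (p⊆q v∈)
  Dominated-mono p⊆q (inj₂ (w , w∈ , a)) = inj₂ (w , p⊆q w∈ , a)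

  RootedDominatingSet-mono : ∀ {p q} → p ⊆ q → RootedDominatingSet adj u p → RootedDominatingSet adj u q
  RootedDominatingSet-mono p⊆q rds v v≢u = Dominated-mono p⊆q (rds v v≢u)

module Minimum {n} {adj : Adj (suc n)} {u : Fin (suc n)} {g : ℕ} (isg : IsRootedDomNum adj u g) where

  ∣min∣≤ : ∀ {S} → MinRootedDominatingSet adj u S → ∣ S ∣ ≤ g
  ∣min∣≤ (_ , min) = let S₀ , rds₀ , ∣S₀∣≡g = proj₁ isg in subst (_ ≤_) ∣S₀∣≡g (min S₀ rds₀)

  some-min : ∃ λ S → MinRootedDominatingSet adj u S
  some-min = let S₀ , rds₀ , ∣S₀∣≡g = proj₁ isg
             in S₀ , rds₀ , λ T rds → subst (_≤ ∣ T ∣) (sym ∣S₀∣≡g) (proj₂ isg T rds)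

  non-min⇒< : ∀ {T} → RootedDominatingSet adj u T → ¬ MinRootedDominatingSet adj u T → g < ∣ T ∣
  non-min⇒< {T} rds ¬min with ∣ T ∣ ≤? g
  ... | yes ∣T∣≤g = contradiction (rds , λ T′ rds′ → ≤-trans ∣T∣≤g (proj₂ isg T′ rds′)) ¬min
  ... | no ∣T∣≰g  = ≰⇒> ∣T∣≰g

  ¬root⇒lookup≡false : ∀ {S} → ¬ HasMinRDSWithRoot adj u → MinRootedDominatingSet adj u S →
    lookup S u ≡ false
  ¬root⇒lookup≡false {S} ¬root min with lookup S u in eq
  ... | true  = contradiction (S , min , lookup⇒[]= u S eq) ¬root
  ... | false = refl

  ≤-insertAt : ∀ {Y b} → RootedDominatingSet adj u (insertAt Y u b) → g ≤ fromBool b + ∣ Y ∣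
  ≤-insertAt {Y} {b} rds = subst (g ≤_) (∣insertAt∣ Y u b) (proj₂ isg _ rds)

  ¬root⇒≤ : ∀ {Y b} → ¬ HasMinRDSWithRoot adj u → RootedDominatingSet adj u (insertAt Y u b) →
    g ≤ ∣ Y ∣
  ¬root⇒≤ {b = false} ¬root rds = ≤-insertAt rds
  ¬root⇒≤ {Y} {true}  ¬root rds = s≤s⁻¹ (subst (g <_) (∣insertAt∣ Y u true)
    (non-min⇒< rds λ min → ¬root (_ , min , ∈-insertAt-inside Y u)))

  ¬nbr⇒< : ∀ {Y j} → (∀ v w → adj v w ≡ adj w v) → ¬ HasMinRDSWithNbr adj u →
    RootedDominatingSet adj u (insertAt Y u false) → j ∈ Y → adj (punchIn u j) u ≡ true → g < ∣ Y ∣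
  ¬nbr⇒< {Y} {j} symmetric ¬nbr rds j∈Y a = subst (g <_) (∣insertAt∣ Y u false)
    (non-min⇒< rds λ min → ¬nbr (_ , min , punchIn u j , trans (symmetric u _) a , ∈-insertAt-punchIn u false j∈Y))

module Fusion {n1 m} (adj1 : Adj n1) (u1 : Fin n1) (adj2 : Adj (suc m)) (u2 : Fin (suc m)) where

  H : Adj (n1 + m)
  H = fuseAdj adj1 u1 adj2 u2

  Vertex : Set
  Vertex = Fin n1 ⊎ Fin m

  adjᶠ : Vertex → Vertex → Bool
  adjᶠ (inj₁ x) (inj₁ y) = adj1 x y
  adjᶠ (inj₁ x) (inj₂ j) = eqᵇ x u1 ∧ adj2 u2 (punchIn u2 j)
  adjᶠ (inj₂ i) (inj₁ y) = eqᵇ y u1 ∧ adj2 (punchIn u2 i) u2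
  adjᶠ (inj₂ i) (inj₂ j) = adj2 (punchIn u2 i) (punchIn u2 j)

  fuseAdj-splitAt : ∀ a b → H a b ≡ adjᶠ (splitAt n1 a) (splitAt n1 b)
  fuseAdj-splitAt a b with splitAt n1 a | splitAt n1 b
  ... | inj₁ x | inj₁ y = refl
  ... | inj₁ x | inj₂ j = refl
  ... | inj₂ i | inj₁ y = refl
  ... | inj₂ i | inj₂ j = refl

  _∈ᶠ_ : Vertex → Subset n1 × Subset m → Set
  inj₁ x ∈ᶠ (X , Y) = x ∈ X
  inj₂ j ∈ᶠ (X , Y) = j ∈ Y

  Dominatedᶠ : Subset n1 × Subset m → Vertex → Set
  Dominatedᶠ D s = s ∈ᶠ D ⊎ ∃ λ t → t ∈ᶠ D × adjᶠ t s ≡ true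

  Dominated⇒Dominatedᶠ : ∀ {X Y x} → Dominated adj1 X x → Dominatedᶠ (X , Y) (inj₁ x)
  Dominated⇒Dominatedᶠ (inj₁ x∈)           = inj₁ x∈
  Dominated⇒Dominatedᶠ (inj₂ (y , y∈ , a)) = inj₂ (inj₁ y , y∈ , a)

  module _ {X : Subset n1} {Y : Subset m} where

    private
      ∈ᶠ⇒lookup : ∀ s → s ∈ᶠ (X , Y) → [ lookup X , lookup Y ]′ s ≡ true
      ∈ᶠ⇒lookup (inj₁ x) = []=⇒lookup
      ∈ᶠ⇒lookup (inj₂ j) = []=⇒lookup

      lookup⇒∈ᶠ : ∀ s → [ lookup X , lookup Y ]′ s ≡ true → s ∈ᶠ (X , Y)
      lookup⇒∈ᶠ (inj₁ x) = lookup⇒[]= x X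
      lookup⇒∈ᶠ (inj₂ j) = lookup⇒[]= j Y

    ∈-++⁻ : ∀ a → a ∈ X ++ Y → splitAt n1 a ∈ᶠ (X , Y)
    ∈-++⁻ a a∈ = lookup⇒∈ᶠ (splitAt n1 a) (trans (sym (lookup-splitAt n1 X Y a)) ([]=⇒lookup a∈))

    ∈-++⁺ : ∀ s → s ∈ᶠ (X , Y) → join n1 m s ∈ X ++ Y
    ∈-++⁺ s s∈ = lookup⇒[]= _ _ (begin
      lookup (X ++ Y) (join n1 m s)                        ≡⟨ lookup-splitAt n1 X Y (join n1 m s) ⟩
      [ lookup X , lookup Y ]′ (splitAt n1 (join n1 m s))  ≡⟨ cong [ lookup X , lookup Y ]′ (splitAt-join n1 m s) ⟩
      [ lookup X , lookup Y ]′ s                           ≡⟨ ∈ᶠ⇒lookup s s∈ ⟩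
      true                                                 ∎)
      where open ≡-Reasoning

    dominating⇒Dominatedᶠ : DominatingSet H (X ++ Y) → ∀ s → Dominatedᶠ (X , Y) s
    dominating⇒Dominatedᶠ dom s with dom (join n1 m s)
    ... | inj₁ s∈ = inj₁ (subst (_∈ᶠ (X , Y)) (splitAt-join n1 m s) (∈-++⁻ _ s∈))
    ... | inj₂ (b , b∈ , a) = inj₂ (splitAt n1 b , ∈-++⁻ b b∈ ,
      subst (λ t → adjᶠ (splitAt n1 b) t ≡ true) (splitAt-join n1 m s) (trans (sym (fuseAdj-splitAt b _)) a))

    Dominatedᶠ⇒dominating : (∀ s → Dominatedᶠ (X , Y) s) → DominatingSet H (X ++ Y)
    Dominatedᶠ⇒dominating dom a with dom (splitAt n1 a)
    ... | inj₁ s∈ = inj₁ (subst (_∈ X ++ Y) (join-splitAt n1 m a) (∈-++⁺ _ s∈))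
    ... | inj₂ (t , t∈ , adj) = inj₂ (join n1 m t , ∈-++⁺ t t∈ ,
      trans (fuseAdj-splitAt (join n1 m t) a)
            (subst (λ t′ → adjᶠ t′ (splitAt n1 a) ≡ true) (sym (splitAt-join n1 m t)) adj))

  module Restriction {X : Subset n1} {Y : Subset m} (dom : ∀ s → Dominatedᶠ (X , Y) s) where

    restrict₁ : RootedDominatingSet adj1 u1 X
    restrict₁ x x≢u1 with dom (inj₁ x)
    ... | inj₁ x∈                = inj₁ x∈
    ... | inj₂ (inj₁ y , y∈ , a) = inj₂ (y , y∈ , a)
    ... | inj₂ (inj₂ j , _  , a) = contradiction (proj₁ (eqᵇ-∧-true x u1 a)) x≢u1

    restrict₂ : RootedDominatingSet adj2 u2 (insertAt Y u2 (lookup X u1))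
    restrict₂ v v≢u2 with punchView u2 v
    ... | at-i      = contradiction refl v≢u2
    ... | punched j with dom (inj₂ j)
    ...   | inj₁ j∈                = inj₁ (∈-insertAt-punchIn u2 _ j∈)
    ...   | inj₂ (inj₂ i , i∈ , a) = inj₂ (punchIn u2 i , ∈-insertAt-punchIn u2 _ i∈ , a)
    ...   | inj₂ (inj₁ x , x∈ , a) with eqᵇ-∧-true x u1 a
    ...     | refl , a′ = inj₂ (u2 , ∈-insertAt-lookup Y u2 x∈ , a′)

    restrict-root : Dominated adj1 X u1 ⊎
      (lookup X u1 ≡ false × ∃ λ j → j ∈ Y × adj2 (punchIn u2 j) u2 ≡ true)
    restrict-root with lookup X u1 in eq
    ... | true = inj₁ (inj₁ (lookup⇒[]= u1 X eq))
    ... | false with dom (inj₁ u1)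
    ...   | inj₁ u1∈               = inj₁ (inj₁ u1∈)
    ...   | inj₂ (inj₁ y , y∈ , a) = inj₁ (inj₂ (y , y∈ , a))
    ...   | inj₂ (inj₂ j , j∈ , a) = inj₂ (refl , j , j∈ , proj₂ (eqᵇ-∧-true u1 u1 a))

  -- Irreflexivity at u2 ensures that a G₂-neighbour of u2 dominating u1 survives the removal of u2.
  glue : ∀ {X S} → adj2 u2 u2 ≡ false →
    RootedDominatingSet adj1 u1 X → RootedDominatingSet adj2 u2 S → (u2 ∈ S → u1 ∈ X) →
    Dominated adj1 X u1 ⊎ (∃ λ w → w ∈ S × adj2 w u2 ≡ true) →
    ∀ s → Dominatedᶠ (X , removeAt S u2) s
  glue irreflexive rds₁ rds₂ root∈ root-dom (inj₁ x) with x ≟ u1 | root-dom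
  ... | no x≢u1  | _      = Dominated⇒Dominatedᶠ (rds₁ x x≢u1)
  ... | yes refl | inj₁ d = Dominated⇒Dominatedᶠ d
  ... | yes refl | inj₂ (w , w∈ , a) with punchView u2 w
  ...   | at-i      = contradiction (trans (sym irreflexive) a) λ ()
  ...   | punched k = inj₂ (inj₂ k , ∈-removeAt-punchIn u2 w∈ , eqᵇ-refl-∧ u1 a)
  glue irreflexive rds₁ rds₂ root∈ root-dom (inj₂ j) with rds₂ (punchIn u2 j) (punchInᵢ≢i u2 j)
  ... | inj₁ j∈ = inj₁ (∈-removeAt-punchIn u2 j∈)
  ... | inj₂ (w , w∈ , a) with punchView u2 w
  ...   | at-i      = inj₂ (inj₁ u1 , root∈ w∈ , eqᵇ-refl-∧ u1 a)
  ...   | punched k = inj₂ (inj₂ k , ∈-removeAt-punchIn u2 w∈ , a)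

module Comparison {n1 m m′} (adj1 : Adj n1) (u1 : Fin n1)
  (adj2 : Adj (suc m)) (u2 : Fin (suc m)) (adj2′ : Adj (suc m′)) (u2′ : Fin (suc m′))
  (irreflexive : adj2 u2 u2 ≡ false)
  (symmetric : ∀ v w → adj2 v w ≡ adj2 w v) (symmetric′ : ∀ v w → adj2′ v w ≡ adj2′ w v)
  {h g g′ : ℕ} (isH : IsDomNum (fuseAdj adj1 u1 adj2 u2) h)
  (isg : IsRootedDomNum adj2 u2 g) (isg′ : IsRootedDomNum adj2′ u2′ g′) where

  open Fusion adj1 u1 adj2 u2 using (glue; Dominatedᶠ⇒dominating)
  open Fusion adj1 u1 adj2′ u2′ using (dominating⇒Dominatedᶠ; module Restriction)
  open Minimum isg using (∣min∣≤; some-min; ¬root⇒lookup≡false)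
  open Minimum isg′ using (≤-insertAt; ¬root⇒≤; ¬nbr⇒<)

  glue-bound : ∀ {X S} → RootedDominatingSet adj1 u1 X → MinRootedDominatingSet adj2 u2 S →
    (u2 ∈ S → u1 ∈ X) → Dominated adj1 X u1 ⊎ (∃ λ w → w ∈ S × adj2 w u2 ≡ true) →
    fromBool (lookup S u2) + h ≤ ∣ X ∣ + g
  glue-bound {X} {S} rds₁ min root∈ root-dom = begin
    fromBool (lookup S u2) + h                           ≤⟨ +-monoʳ-≤ _ h≤ ⟩
    fromBool (lookup S u2) + (∣ X ∣ + ∣ removeAt S u2 ∣) ≡⟨ swap-first _ ∣ X ∣ ∣ removeAt S u2 ∣ ⟩
    ∣ X ∣ + (fromBool (lookup S u2) + ∣ removeAt S u2 ∣) ≡⟨ cong (∣ X ∣ +_) (∣removeAt∣ S u2) ⟨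
    ∣ X ∣ + ∣ S ∣                                        ≤⟨ +-monoʳ-≤ ∣ X ∣ (∣min∣≤ min) ⟩
    ∣ X ∣ + g                                            ∎
    where
    open ≤-Reasoning
    h≤ : h ≤ ∣ X ∣ + ∣ removeAt S u2 ∣
    h≤ = subst (h ≤_) (∣++∣ X _)
      (proj₂ isH _ (Dominatedᶠ⇒dominating (glue irreflexive rds₁ (proj₁ min) root∈ root-dom)))
    swap-first : ∀ a x r → a + (x + r) ≡ x + (a + r)
    swap-first = solve-∀

  module _ {X : Subset n1} {Y : Subset m′} (dom : DominatingSet (fuseAdj adj1 u1 adj2′ u2′) (X ++ Y)) where

    open Restriction (dominating⇒Dominatedᶠ {X} {Y} dom) using (restrict₁; restrict₂; restrict-root)

    combine : ∀ a c x y → a + h ≤ x + g → c + g′ ≤ y → x + y ≡ a + c + (∣ X ∣ + ∣ Y ∣) →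
      h + g′ ≤ ∣ X ∣ + ∣ Y ∣ + g
    combine a c x y = combine-bounds a c (∣ X ∣ + ∣ Y ∣) h g g′ x y

    X⁺ : Subset n1
    X⁺ = X [ u1 ]≔ inside

    glue-bound⁺ : ∀ {S} → MinRootedDominatingSet adj2 u2 S → fromBool (lookup S u2) + h ≤ ∣ X⁺ ∣ + g
    glue-bound⁺ min = glue-bound (RootedDominatingSet-mono (⊆-[]≔inside X u1) restrict₁) min
      (λ _ → []≔-updates X u1) (inj₁ (inj₁ ([]≔-updates X u1)))

    bound-root : ∀ {S} → MinRootedDominatingSet adj2 u2 S → u2 ∈ S → h + g′ ≤ ∣ X ∣ + ∣ Y ∣ + g
    bound-root {S} min u2∈S = combine 1 0 ∣ X⁺ ∣ (fromBool (lookup X u1) + ∣ Y ∣)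
      (subst (λ b → fromBool b + h ≤ ∣ X⁺ ∣ + g) ([]=⇒lookup u2∈S) (glue-bound⁺ min))
      (≤-insertAt restrict₂)
      (trans (sym (+-assoc ∣ X⁺ ∣ _ (∣ Y ∣))) (cong (_+ ∣ Y ∣) (∣[]≔inside∣ X u1)))

    bound-no-root : ∀ {S} → ¬ HasMinRDSWithRoot adj2 u2 → ¬ HasMinRDSWithRoot adj2′ u2′ →
      MinRootedDominatingSet adj2 u2 S → Dominated adj1 X u1 ⊎ (∃ λ w → w ∈ S × adj2 w u2 ≡ true) →
      h + g′ ≤ ∣ X ∣ + ∣ Y ∣ + g
    bound-no-root ¬root ¬root′ min root-dom = combine 0 0 ∣ X ∣ ∣ Y ∣
      (subst (λ b → fromBool b + h ≤ ∣ X ∣ + g) (¬root⇒lookup≡false ¬root min)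
        (glue-bound restrict₁ min (λ u2∈S → contradiction (_ , min , u2∈S) ¬root) root-dom))
      (¬root⇒≤ ¬root′ restrict₂)
      refl

    bound-undominated-root : ¬ HasMinRDSWithRoot adj2 u2 → ¬ HasMinRDSWithNbr adj2′ u2′ →
      lookup X u1 ≡ false → ∀ {j} → j ∈ Y → adj2′ (punchIn u2′ j) u2′ ≡ true →
      h + g′ ≤ ∣ X ∣ + ∣ Y ∣ + g
    bound-undominated-root ¬root ¬nbr′ u1∉X j∈Y a = combine 0 1 ∣ X⁺ ∣ ∣ Y ∣
      (subst (λ b → fromBool b + h ≤ ∣ X⁺ ∣ + g) (¬root⇒lookup≡false ¬root min) (glue-bound⁺ min))
      (¬nbr⇒< symmetric′ ¬nbr′ (subst (λ b → RootedDominatingSet adj2′ u2′ (insertAt Y u2′ b)) u1∉X restrict₂) j∈Y a)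
      (cong (_+ ∣ Y ∣) ∣X⁺∣≡)
      where
      min = proj₂ some-min
      ∣X⁺∣≡ : ∣ X⁺ ∣ ≡ suc ∣ X ∣
      ∣X⁺∣≡ = begin
        ∣ X⁺ ∣                          ≡⟨ +-identityʳ ∣ X⁺ ∣ ⟨
        ∣ X⁺ ∣ + fromBool false         ≡⟨ cong (λ b → ∣ X⁺ ∣ + fromBool b) u1∉X ⟨
        ∣ X⁺ ∣ + fromBool (lookup X u1) ≡⟨ ∣[]≔inside∣ X u1 ⟩
        suc ∣ X ∣                       ∎
        where open ≡-Reasoning

    bound : (t : ActType) → ActsAs adj2 u2 t → ActsAs adj2′ u2′ t → h + g′ ≤ ∣ X ∣ + ∣ Y ∣ + g
    bound AB (S , min , u2∈S) _ = bound-root min u2∈S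
    bound LR (¬root , S , min , w , a , w∈S) (¬root′ , _) =
      bound-no-root ¬root ¬root′ min
        ([ inj₁ , (λ _ → inj₂ (w , w∈S , trans (symmetric w u2) a)) ]′ restrict-root)
    bound Nope (¬root , _) (¬root′ , ¬nbr′) with restrict-root
    ... | inj₁ u1-dominated          = bound-no-root ¬root ¬root′ (proj₂ some-min) (inj₁ u1-dominated)
    ... | inj₂ (u1∉X , j , j∈Y , a) = bound-undominated-root ¬root ¬nbr′ u1∉X j∈Y a

  fused-bound : ∀ {h′} → IsDomNum (fuseAdj adj1 u1 adj2′ u2′) h′ →
    (t : ActType) → ActsAs adj2 u2 t → ActsAs adj2′ u2′ t → h + g′ ≤ h′ + g
  fused-bound ((D , dom , ∣D∣≡h′) , _) t act act′ with Vec.splitAt n1 D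
  ... | X , Y , refl =
    subst (λ k → h + g′ ≤ k + g) (trans (sym (∣++∣ X Y)) ∣D∣≡h′) (bound {X} {Y} dom t act act′)

lemma2 : ∀ {n1 m2 m2' : ℕ}
    (adj1 : Adj n1) (u1 : Fin n1)
    (adj2 : Adj (suc m2)) (u2 : Fin (suc m2))
    (adj2' : Adj (suc m2')) (u2' : Fin (suc m2')) →
    SkeletalTriangulation adj1 u1 →
    SkeletalTriangulation adj2 u2 →
    SkeletalTriangulation adj2' u2' →
    (t : ActType) → ActsAs adj2 u2 t → ActsAs adj2' u2' t →
    (h h' g g' : ℕ) →
    IsDomNum (fuseAdj adj1 u1 adj2 u2) h →
    IsDomNum (fuseAdj adj1 u1 adj2' u2') h' →
    IsRootedDomNum adj2 u2 g →
    IsRootedDomNum adj2' u2' g' →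
    h + g' ≡ h' + g
lemma2 adj1 u1 adj2 u2 adj2' u2' _ G₂ G₂′ t act act′ h h' g g' isH isH′ isg isg′ = ≤-antisym
  (Comparison.fused-bound adj1 u1 adj2 u2 adj2' u2'
    (irreflexive G₂ u2) (symmetric G₂) (symmetric G₂′) isH isg isg′ isH′ t act act′)
  (Comparison.fused-bound adj1 u1 adj2' u2' adj2 u2
    (irreflexive G₂′ u2') (symmetric G₂′) (symmetric G₂) isH′ isg′ isg isH t act′ act)
  where open SkeletalTriangulation
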